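{- For all names $P,Q$: if $\eta\,Q\,\mathit{Region}$ and $\eta\,P\,(\partial\,Q)$, then $\neg\big((\partial\,Q)\approx\mathit{Region}\big)$.
   Context: Setting: a Coq formalization (classical logic) of Leśniewski's Ontology and Mereology extended with Tarski's geometry of solids. Names form a type $N$ with a primitive relation $\eta:N\to N\to\mathrm{Prop}$ satisfying Leśniewski's ontological axiom $\eta\,A\,b \leftrightarrow ((\exists C,\eta\,C\,A)\wedge(\forall C\,D,\eta\,C\,A\wedge\eta\,D\,A\to\eta\,C\,D)\wedge(\forall C,\eta\,C\,A\to\eta\,C\,b))$; $A$ is an individual iff $\eta\,A\,A$; $a\subseteq b$ means $\forall P,\eta\,P\,a\to\eta\,P\,b$; $a\approx b$ means $\forall P,\ \eta\,P\,a\leftrightarrow\eta\,P\,b$. Mereology: $pt:N\to N$ ($\eta\,B\,(pt\,A)$: $B$ is a part of $A$) satisfying Leśniewski's mereology axioms (part-of a partial order on individuals; every non-empty name has a unique m-class). M-class: $\eta\,A\,(klass\,a)$ iff $\eta\,A\,A$, $\forall B,\eta\,B\,a\to\eta\,B\,(pt\,A)$, and $\forall B,\eta\,B\,(pt\,A)\to\exists C\,D,\eta\,C\,a\wedge\eta\,D\,(pt\,C)\wedge\eta\,D\,(pt\,B)$. $\eta\,P\,(ext\,Q)$ iff $P,Q$ are individuals with no common part ("exterior"). Geometry: $\mathit{balls}$ is a primitive name (there exists at least one ball). Tarski's definitions for balls: $A$ is externally tangent to $B$ iff $A$ is exterior to $B$ and for any balls $X,Y$ both having $A$ as part and both exterior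 to $B$, one of $X,Y$ is part of the other; $A$ is internally tangent to $B$ iff $A$ is a proper part of $B$ and for any balls $X,Y$ both having $A$ as a part and both parts of $B$, one of $X,Y$ is part of the other; $A,B$ are externally diametrical w.r.t. $C$ iff both are externally tangent to $C$ and for any balls $X,Y$ exterior to $C$ with $A$ part of $X$ and $B$ part of $Y$, $X$ is exterior to $Y$; $A,B$ are internally diametrical w.r.t. $C$ iff both are internally tangent to $C$ and for any balls $X,Y$ externally tangent to $C$ with $A$ exterior to $X$ and $B$ exterior to $Y$, $X$ is exterior to $Y$; $A$ is concentric with $B$ iff $A=B$, or $A$ is a proper part of $B$ and any balls $X,Y$ externally diametrical w.r.t. $A$ and internally tangent to $B$ are internally diametrical w.r.t. $B$, or the same holds with $A,B$ interchanged. $\eta\,P\,(\mathit{Concent}\,Q)$ iff $P,Q$ are balls and $P$ is concentric with $Q$. Point: $\eta\,P\,(\mathit{Point}\,Q)$ iff $\eta\,P\,\mathit{balls}\wedge\eta\,Q\,\mathit{balls}\wedge\eta\,P\,(\mathit{Concent}\,Q)$. Region: $\eta\,P\,\mathit{Region}$ iff $\eta\,P\,P$ and $\exists b,\ b\subseteq\mathit{balls}\wedge\eta\,P\,(klass\,b)$. Boundary: $\eta\,P\,(\partial\,Q)$ iff $\eta\,Q\,\mathit{Region}$, $\eta\,P\,\mathit{balls}$, and $\forall Y,\ (\eta\,Y\,\mathit{balls}\wedge\eta\,P\,(\mathit{Point}\,Y))\to(\neg\eta\,Y\,(pt\,Q)\wedge\neg\eta\,Y\,(ext\,Q))$. -}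

module Defs where

open import Level using (suc; zero)
open import Data.Product using (Σ; ∃; _×_; _,_)
open import Data.Sum using (_⊎_)
open import Relation.Nullary using (¬_)
open import Relation.Binary.PropositionalEquality using (_≡_)
open import Function.Bundles using (_⇔_)

record Base : Set₁ where
  field
    N   : Set
    η   : N → N → Set
    em  : (A : Set) → A ⊎ ¬ A
    -- Leśniewski's ontological axiom
    ontology : ∀ A b → η A b ⇔
      ((∃ λ C → η C A) × (∀ C D → η C A → η D A → η C D) × (∀ C → η C A → η C b))
    -- Mereology: pt A is the name of the parts of A
    pt  : N → N
    pt-ind   : ∀ A B → η A (pt B) → η A A × η B B
    pt-refl  : ∀ A → η A A → η A (pt A)
    pt-antis : ∀ A B → η A (pt B) → η B (pt A) → η A B
    pt-trans : ∀ A B C → η A (pt B) → η B (pt C) → η A (pt C)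
    klass : N → N
    klass-def : ∀ A a → η A (klass a) ⇔
      (η A A × (∀ B → η B a → η B (pt A)) ×
       (∀ B → η B (pt A) → ∃ λ C → ∃ λ D → η C a × η D (pt C) × η D (pt B)))
    klass-exists : ∀ a → (∃ λ C → η C a) → ∃ λ A → η A (klass a)
    klass-unique : ∀ a A B → η A (klass a) → η B (klass a) → η A B
    ext : N → N
    ext-def : ∀ P Q → η P (ext Q) ⇔
      (η P P × η Q Q × ¬ (∃ λ C → η C (pt P) × η C (pt Q)))
    balls : N
    balls-nonempty : ∃ λ B → η B balls

module BaseDefs (M : Base) where
  open Base M

  _⊆_ : N → N → Set
  a ⊆ b = ∀ P → η P a → η P b

  _≈_ : N → N → Set
  a ≈ b = ∀ P → (η P a ⇔ η P b)

  properPart : N → N → Set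
  properPart A B = η A (pt B) × ¬ η B (pt A)

  -- Tarski's definitions
  ExtTangent : N → N → Set
  ExtTangent A B = η A (ext B) ×
    (∀ X Y → η X balls → η Y balls → η A (pt X) → η A (pt Y) →
      η X (ext B) → η Y (ext B) → η X (pt Y) ⊎ η Y (pt X))

  IntTangent : N → N → Set
  IntTangent A B = properPart A B ×
    (∀ X Y → η X balls → η Y balls → η A (pt X) → η A (pt Y) →
      η X (pt B) → η Y (pt B) → η X (pt Y) ⊎ η Y (pt X))

  ExtDiam : N → N → N → Set
  ExtDiam A B C = ExtTangent A C × ExtTangent B C ×
    (∀ X Y → η X balls → η Y balls → η X (ext C) → η Y (ext C) →
      η A (pt X) → η B (pt Y) → η X (ext Y))

  IntDiam : N → N → N → Set
  IntDiam A B C = IntTangent A C × IntTangent B C ×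
    (∀ X Y → η X balls → η Y balls → ExtTangent X C → ExtTangent Y C →
      η A (ext X) → η B (ext Y) → η X (ext Y))

  Concentric : N → N → Set
  Concentric A B = A ≡ B
    ⊎ (properPart A B × (∀ X Y → η X balls → η Y balls →
         ExtDiam X Y A → IntTangent X B → IntTangent Y B → IntDiam X Y B))
    ⊎ (properPart B A × (∀ X Y → η X balls → η Y balls →
         ExtDiam X Y B → IntTangent X A → IntTangent Y A → IntDiam X Y A))

record Geo (M : Base) : Set₁ where
  open Base M
  open BaseDefs M
  field
    Concent : N → N
    Concent-def : ∀ P Q → η P (Concent Q) ⇔ (η P balls × η Q balls × Concentric P Q)
    Point : N → N
    Point-def : ∀ P Q → η P (Point Q) ⇔ (η P balls × η Q balls × η P (Concent Q))
    Region : N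
    Region-def : ∀ P → η P Region ⇔ (η P P × ∃ λ b → b ⊆ balls × η P (klass b))
    ∂ : N → N
    ∂-def : ∀ P Q → η P (∂ Q) ⇔
      (η Q Region × η P balls ×
       (∀ Y → (η Y balls × η P (Point Y)) → (¬ η Y (pt Q) × ¬ η Y (ext Q))))

module Submission where

open import Defs
open import Relation.Nullary using (¬_)
open import Data.Product using (_,_; proj₁; proj₂)
open import Data.Sum using (inj₁)
open import Function.Bundles using (Equivalence)
open import Relation.Binary.PropositionalEquality using (refl)

-- A ball is a point of itself, hence no region belongs to its own boundary
-- (it would be a part of itself).  If ∂ Q and Region had the same members,
-- the region Q would be such a member of its own boundary.

open Equivalence

module _ (M : Base) where
  open Base M

  η-refl : ∀ {A b} → η A b → η A A
  η-refl {A} {b} A∈b with to (ontology A b) A∈b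
  ... | nonempty , unique , _ = from (ontology A A) (nonempty , unique , λ _ C∈A → C∈A)

  module _ (G : Geo M) where
    open Geo G

    ball-point-self : ∀ {Q} → η Q balls → η Q (Point Q)
    ball-point-self Q∈balls =
      from (Point-def _ _) (Q∈balls , Q∈balls ,
        from (Concent-def _ _) (Q∈balls , Q∈balls , inj₁ refl))

    ∉-own-∂ : ∀ {Q} → ¬ η Q (∂ Q)
    ∉-own-∂ {Q} Q∈∂Q with to (∂-def Q Q) Q∈∂Q
    ... | _ , Q∈balls , avoids =
      proj₁ (avoids Q (Q∈balls , ball-point-self Q∈balls)) (pt-refl Q (η-refl Q∈balls))

lemma10 : (M : Base) (G : Geo M) (P Q : Base.N M) →
    Base.η M Q (Geo.Region G) → Base.η M P (Geo.∂ G Q) →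
    ¬ (BaseDefs._≈_ M (Geo.∂ G Q) (Geo.Region G))
lemma10 M G P Q Q∈Region _ ∂Q≈Region = ∉-own-∂ M G (from (∂Q≈Region Q) Q∈Region)
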